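{- Let $G$ be a finite supersolvable group with chief series $G=N_1\rhd N_2\rhd\dots\rhd N_{k+1}=1$. (1) If $K\le G$ and $B$ is a maximal subgroup of $G$ with $KB=G$, then $K\cap B$ is a maximal subgroup of $K$. (2) If $K_1$ is a maximal subgroup of $K_0$ with $\lambda^{ss}(K_0\supset K_1)=i$, then for any complement $B_i$ to $N_i/N_{i+1}$ and any subgroup $K\supseteq K_0$, we have $K_0B_i=KB_i=G$.
   Context: A complement to $N_i/N_{i+1}$ is a subgroup $B_i\le G$ with $N_iB_i=G$ and $N_i\cap B_i=N_{i+1}$. For a cover relation $K_0\supset K_1$ in the subgroup lattice ($K_1$ maximal in $K_0$), $\lambda^{ss}(K_0\supset K_1)=\max\{i:N_iK_1\supseteq K_0\}=\min\{i:N_{i+1}\cap K_0\subseteq K_1\}$. -}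

module Defs where

open import Data.Nat using (ℕ; zero; suc; _≤_; _<_)
open import Data.Fin using (Fin)
open import Data.Fin.Subset using (Subset; _∈_; _⊆_; _⊂_; _∩_; ⊤; ⁅_⁆)
open import Data.Product using (Σ; ∃; ∃₂; _×_; _,_)
open import Data.Sum using (_⊎_)
open import Relation.Nullary using (¬_)
open import Relation.Binary.PropositionalEquality using (_≡_)
open import Algebra.Structures using (IsGroup)

-- A finite group of order n, presented with carrier Fin n and
-- propositional equality (every finite group is isomorphic to one of these).
record FinGroup (n : ℕ) : Set where
  field
    _∙_     : Fin n → Fin n → Fin n
    ε       : Fin n
    _⁻¹     : Fin n → Fin n
    isGroup : IsGroup _≡_ _∙_ ε _⁻¹

module _ {n : ℕ} (G : FinGroup n) where
  open FinGroup G

  pow : Fin n → ℕ → Fin n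
  pow g zero    = ε
  pow g (suc m) = g ∙ pow g m

  IsSubgroup : Subset n → Set
  IsSubgroup H = (ε ∈ H)
               × (∀ x y → x ∈ H → y ∈ H → (x ∙ y) ∈ H)
               × (∀ x → x ∈ H → (x ⁻¹) ∈ H)

  IsNormalSubgroup : Subset n → Set
  IsNormalSubgroup H = IsSubgroup H × (∀ g x → x ∈ H → ((g ∙ x) ∙ (g ⁻¹)) ∈ H)

  InProd : Subset n → Subset n → Fin n → Set
  InProd H K g = ∃₂ λ h k → h ∈ H × k ∈ K × g ≡ h ∙ k

  ProdIsWhole : Subset n → Subset n → Set
  ProdIsWhole H K = ∀ g → InProd H K g

  -- H is a maximal subgroup of K (K is assumed to be a subgroup separately)
  IsMaximalIn : Subset n → Subset n → Set
  IsMaximalIn K H = IsSubgroup H × H ⊂ K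
                  × (∀ L → IsSubgroup L → H ⊆ L → L ⊆ K → L ≡ H ⊎ L ≡ K)

  -- M/L is cyclic (L ⊆ M): M = ⟨g⟩ L for some g ∈ M
  CyclicFactor : Subset n → Subset n → Set
  CyclicFactor M L = ∃ λ g → g ∈ M × (∀ x → x ∈ M → ∃₂ λ m y → y ∈ L × x ≡ pow g m ∙ y)

  IsSupersolvable : Set
  IsSupersolvable = ∃₂ λ (r : ℕ) (M : ℕ → Subset n) →
      (M 1 ≡ ⊤) × (M (suc r) ≡ ⁅ ε ⁆)
    × (∀ i → 1 ≤ i → i ≤ suc r → IsNormalSubgroup (M i))
    × (∀ i → 1 ≤ i → i ≤ r → M (suc i) ⊆ M i × CyclicFactor (M i) (M (suc i)))

  IsChiefSeries : ℕ → (ℕ → Subset n) → Set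
  IsChiefSeries k N =
      (N 1 ≡ ⊤) × (N (suc k) ≡ ⁅ ε ⁆)
    × (∀ i → 1 ≤ i → i ≤ suc k → IsNormalSubgroup (N i))
    × (∀ i → 1 ≤ i → i ≤ k → N (suc i) ⊂ N i
         × (∀ L → IsNormalSubgroup L → N (suc i) ⊆ L → L ⊆ N i
                → L ≡ N (suc i) ⊎ L ≡ N i))

  CoveredBy : (ℕ → Subset n) → ℕ → Subset n → Subset n → Set
  CoveredBy N i K₀ K₁ = ∀ g → g ∈ K₀ → InProd (N i) K₁ g

  LambdaSS : ℕ → (ℕ → Subset n) → Subset n → Subset n → ℕ → Set
  LambdaSS k N K₀ K₁ i = 1 ≤ i × i ≤ suc k × CoveredBy N i K₀ K₁
                       × (∀ j → i < j → j ≤ suc k → ¬ CoveredBy N j K₀ K₁)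

  IsComplement : (ℕ → Subset n) → ℕ → Subset n → Set
  IsComplement N i B = IsSubgroup B × ProdIsWhole (N i) B × (N i ∩ B ≡ N (suc i))

-- Both parts rest on one construction: if A is normal in G, S ⊇ A is a subgroup and every
-- conjugate of u is a power of u modulo A, then ⟨u⟩S = {uᵃ s} is a subgroup, normal when S is.
-- In a supersolvable group every element of a cyclic factor H/A of the series has this property.
--
-- (1) Take the factor H/A of the series with A ⊆ B but H ⊈ B. For v ∈ H ∖ B, maximality of B
-- gives ⟨v⟩B = G. For K∩B ⊆ L ⊆ K and y ∈ L ∖ B one finds w ∈ L with ⟨w⟩B = G, which forces
-- K ⊆ L. Modulo D = H ∩ B (normal in G) the group H/D is abelian; if y = h b (h ∈ H, b ∈ B)
-- with [h, b] ∈ D then w = y works, and otherwise some conjugate z of y by K lies in K ∩ B and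
-- w = y z⁻¹ is a commutator, which centralises H/A and again gives ⟨w⟩B = G.
--
-- (2) λˢˢ(K₀ ⊃ K₁) = i yields m ∈ K₀ ∩ Nᵢ outside Nᵢ₊₁. Choosing a cyclic factor H/A of the
-- supersolvable series with H ∩ Nᵢ ⊈ Nᵢ₊₁ but A ∩ Nᵢ ⊆ Nᵢ₊₁ produces such a u in Nᵢ, so
-- ⟨u⟩Nᵢ₊₁ = Nᵢ by minimality of the chief factor; then m ≡ uᵃ inherits the property and also
-- ⟨m⟩Nᵢ₊₁ = Nᵢ. Hence G = Nᵢ Bᵢ = ⟨m⟩Nᵢ₊₁Bᵢ = ⟨m⟩Bᵢ ⊆ K₀Bᵢ.

module Submission where

open import Defs
open import Data.Nat using (ℕ; zero; suc; _+_; _*_; _∸_; _≤_; s≤s; z≤n)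
open import Data.Nat.Properties using (≤-refl; m≤n⇒m≤1+n; +-comm; +-suc; *-comm; *-suc; *-zeroʳ; m+[n∸m]≡n; n<1+n; m≤n⇒m<n∨m≡n)
open import Data.Fin using (Fin; toℕ; fromℕ<)
open import Data.Fin.Properties using (pigeonhole; toℕ-fromℕ<; any?; ¬∀⟶∃¬)
open import Data.Nat.Tactic.RingSolver using (solve-∀)
open import Data.Fin.Subset using (Subset; _∈_; _∉_; _⊆_; _⊈_; _⊂_; _∩_; ⊤; ⁅_⁆)
open import Data.Fin.Subset.Properties using (_∈?_; _⊆?_; ∈⊤; ⊆-antisym; x∈⁅y⁆⇒x≡y; x∈p∩q⁺; x∈p∩q⁻; p∩q⊆p; p∩q⊆q)
open import Data.Product using (∃; _×_; _,_; proj₁; proj₂)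
open import Data.Sum using (_⊎_; inj₁; inj₂)
open import Data.Vec using (tabulate)
open import Data.Vec.Properties using (lookup∘tabulate; []=⇒lookup; lookup⇒[]=)
open import Data.Bool using (true)
open import Data.Empty using (⊥-elim)
open import Level using (0ℓ)
open import Relation.Nullary using (¬_; Dec; yes; no; does)
open import Relation.Nullary.Decidable using (map′; _→-dec_; _×-dec_)
open import Relation.Binary.Bundles using (Setoid)
open import Relation.Binary.PropositionalEquality
open import Algebra.Bundles using (Group)
import Algebra.Properties.Group as GroupProperties
import Relation.Binary.Reasoning.Setoid as SetoidReasoning

module _ {n : ℕ} {P : Fin n → Set} (P? : ∀ x → Dec (P x)) where

  opaque
    decSubset : Subset n
    decSubset = tabulate (λ x → does (P? x))

    ∈-decSubset⁻ : ∀ {x} → x ∈ decSubset → P x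
    ∈-decSubset⁻ {x} x∈ = from-does (P? x) (trans (sym (lookup∘tabulate _ x)) ([]=⇒lookup x∈))
      where
      from-does : (d : Dec (P x)) → does d ≡ true → P x
      from-does (yes px) _ = px

    ∈-decSubset⁺ : ∀ {x} → P x → x ∈ decSubset
    ∈-decSubset⁺ {x} px = lookup⇒[]= x decSubset (trans (lookup∘tabulate _ x) (to-does (P? x)))
      where
      to-does : (d : Dec (P x)) → does d ≡ true
      to-does (yes _)  = refl
      to-does (no ¬px) = ⊥-elim (¬px px)

module GroupTheory {n : ℕ} (G : FinGroup n) where

  group : Group 0ℓ 0ℓ
  group = record
    { Carrier = Fin n ; _≈_ = _≡_
    ; _∙_ = FinGroup._∙_ G ; ε = FinGroup.ε G ; _⁻¹ = FinGroup._⁻¹ G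
    ; isGroup = FinGroup.isGroup G }

  open Group group public using (_∙_; ε; _⁻¹; assoc; identityˡ; identityʳ; inverseˡ; inverseʳ)
  open GroupProperties group public using (⁻¹-involutive; ⁻¹-anti-homo-∙; ε⁻¹≈ε; inverseʳ-unique)
  open ≡-Reasoning

  x∙[x⁻¹∙y]≡y : ∀ x y → x ∙ (x ⁻¹ ∙ y) ≡ y
  x∙[x⁻¹∙y]≡y = GroupProperties.\\-leftDividesˡ group

  x⁻¹∙[x∙y]≡y : ∀ x y → x ⁻¹ ∙ (x ∙ y) ≡ y
  x⁻¹∙[x∙y]≡y = GroupProperties.\\-leftDividesʳ group

  x∙y∙y⁻¹≡x : ∀ x y → x ∙ y ∙ y ⁻¹ ≡ x
  x∙y∙y⁻¹≡x x y = GroupProperties.//-rightDividesʳ group y x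

  x∙y⁻¹∙y≡x : ∀ x y → x ∙ y ⁻¹ ∙ y ≡ x
  x∙y⁻¹∙y≡x x y = GroupProperties.//-rightDividesˡ group y x

  x∙y∙[y⁻¹∙z]≡x∙z : ∀ x y z → x ∙ y ∙ (y ⁻¹ ∙ z) ≡ x ∙ z
  x∙y∙[y⁻¹∙z]≡x∙z x y z = trans (assoc x _ _) (cong (x ∙_) (x∙[x⁻¹∙y]≡y y z))

  x∙y⁻¹∙[y∙z]≡x∙z : ∀ x y z → x ∙ y ⁻¹ ∙ (y ∙ z) ≡ x ∙ z
  x∙y⁻¹∙[y∙z]≡x∙z x y z = trans (assoc x _ _) (cong (x ∙_) (x⁻¹∙[x∙y]≡y y z))

  infixr 8 _^_
  _^_ : Fin n → ℕ → Fin n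
  _^_ = pow G

  ^-homo-+ : ∀ g a b → g ^ (a + b) ≡ g ^ a ∙ g ^ b
  ^-homo-+ g zero    b = sym (identityˡ _)
  ^-homo-+ g (suc a) b = trans (cong (g ∙_) (^-homo-+ g a b)) (sym (assoc _ _ _))

  ^-*-assoc : ∀ g a b → (g ^ a) ^ b ≡ g ^ (a * b)
  ^-*-assoc g a zero    = cong (g ^_) (sym (*-zeroʳ a))
  ^-*-assoc g a (suc b) = begin
    g ^ a ∙ (g ^ a) ^ b  ≡⟨ cong (g ^ a ∙_) (^-*-assoc g a b) ⟩
    g ^ a ∙ g ^ (a * b)  ≡⟨ ^-homo-+ g a (a * b) ⟨
    g ^ (a + a * b)      ≡⟨ cong (g ^_) (*-suc a b) ⟨
    g ^ (a * suc b)      ∎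

  ^-comm : ∀ g a → g ∙ g ^ a ≡ g ^ a ∙ g
  ^-comm g zero    = trans (identityʳ g) (sym (identityˡ g))
  ^-comm g (suc a) = trans (cong (g ∙_) (^-comm g a)) (sym (assoc _ _ _))

  ε^ : ∀ a → ε ^ a ≡ ε
  ε^ zero    = refl
  ε^ (suc a) = trans (identityˡ _) (ε^ a)

  ⁻¹-^ : ∀ g a → (g ⁻¹) ^ a ≡ (g ^ a) ⁻¹
  ⁻¹-^ g zero    = sym ε⁻¹≈ε
  ⁻¹-^ g (suc a) = begin
    g ⁻¹ ∙ (g ⁻¹) ^ a  ≡⟨ cong (g ⁻¹ ∙_) (⁻¹-^ g a) ⟩
    g ⁻¹ ∙ (g ^ a) ⁻¹  ≡⟨ ⁻¹-anti-homo-∙ (g ^ a) g ⟨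
    (g ^ a ∙ g) ⁻¹     ≡⟨ cong _⁻¹ (^-comm g a) ⟨
    (g ∙ g ^ a) ⁻¹     ∎

  finite-order : ∀ u → ∃ λ e → u ^ suc e ≡ ε
  finite-order u with pigeonhole (n<1+n n) (λ (i : Fin (suc n)) → u ^ toℕ i)
  ... | i , j , i<j , uⁱ≡uʲ = e , (begin
    u ^ suc e                         ≡⟨ x⁻¹∙[x∙y]≡y (u ^ p) _ ⟨
    (u ^ p) ⁻¹ ∙ (u ^ p ∙ u ^ suc e)  ≡⟨ cong ((u ^ p) ⁻¹ ∙_) (^-homo-+ u p (suc e)) ⟨
    (u ^ p) ⁻¹ ∙ u ^ (p + suc e)      ≡⟨ cong (λ a → (u ^ p) ⁻¹ ∙ u ^ a) (trans (+-suc p e) (m+[n∸m]≡n i<j)) ⟩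
    (u ^ p) ⁻¹ ∙ u ^ toℕ j            ≡⟨ cong ((u ^ p) ⁻¹ ∙_) uⁱ≡uʲ ⟨
    (u ^ p) ⁻¹ ∙ u ^ p                ≡⟨ inverseˡ (u ^ p) ⟩
    ε                                 ∎)
    where
    p e : ℕ
    p = toℕ i
    e = toℕ j ∸ suc p

  module FiniteOrder (u : Fin n) (e : ℕ) (u^e+1≡ε : u ^ suc e ≡ ε) where

    ^-reduce : ∀ a → ∃ λ r → r ≤ e × u ^ a ≡ u ^ r
    ^-reduce zero = zero , z≤n , refl
    ^-reduce (suc a) with ^-reduce a
    ... | r , r≤e , uᵃ≡uʳ with m≤n⇒m<n∨m≡n r≤e
    ... | inj₁ r<e  = suc r , r<e , cong (u ∙_) uᵃ≡uʳ
    ... | inj₂ refl = zero , z≤n , trans (cong (u ∙_) uᵃ≡uʳ) u^e+1≡ε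

    ^-⁻¹ : ∀ a → (u ^ a) ⁻¹ ≡ u ^ (e * a)
    ^-⁻¹ a = sym (inverseʳ-unique (u ^ a) (u ^ (e * a)) (begin
      u ^ a ∙ u ^ (e * a)  ≡⟨ ^-homo-+ u a (e * a) ⟨
      u ^ (suc e * a)      ≡⟨ ^-*-assoc u (suc e) a ⟨
      (u ^ suc e) ^ a      ≡⟨ cong (_^ a) u^e+1≡ε ⟩
      ε ^ a                ≡⟨ ε^ a ⟩
      ε                    ∎))

  conj : Fin n → Fin n → Fin n
  conj g x = g ∙ x ∙ g ⁻¹

  conj-by-ε : ∀ x → conj ε x ≡ x
  conj-by-ε x = trans (cong₂ _∙_ (identityˡ x) ε⁻¹≈ε) (identityʳ x)

  conj-homo-∙ : ∀ x y z → conj (x ∙ y) z ≡ conj x (conj y z)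
  conj-homo-∙ x y z = begin
    x ∙ y ∙ z ∙ (x ∙ y) ⁻¹       ≡⟨ cong₂ _∙_ (assoc x y z) (⁻¹-anti-homo-∙ x y) ⟩
    x ∙ (y ∙ z) ∙ (y ⁻¹ ∙ x ⁻¹)  ≡⟨ assoc (x ∙ (y ∙ z)) _ _ ⟨
    x ∙ (y ∙ z) ∙ y ⁻¹ ∙ x ⁻¹    ≡⟨ cong (_∙ x ⁻¹) (assoc x _ _) ⟩
    x ∙ (y ∙ z ∙ y ⁻¹) ∙ x ⁻¹    ∎

  conj-∙ : ∀ g x y → conj g (x ∙ y) ≡ conj g x ∙ conj g y
  conj-∙ g x y = sym (begin
    g ∙ x ∙ g ⁻¹ ∙ (g ∙ y ∙ g ⁻¹)    ≡⟨ cong (g ∙ x ∙ g ⁻¹ ∙_) (assoc g y _) ⟩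
    g ∙ x ∙ g ⁻¹ ∙ (g ∙ (y ∙ g ⁻¹))  ≡⟨ x∙y⁻¹∙[y∙z]≡x∙z (g ∙ x) g _ ⟩
    g ∙ x ∙ (y ∙ g ⁻¹)               ≡⟨ assoc (g ∙ x) y _ ⟨
    g ∙ x ∙ y ∙ g ⁻¹                 ≡⟨ cong (_∙ g ⁻¹) (assoc g x y) ⟩
    g ∙ (x ∙ y) ∙ g ⁻¹               ∎)

  conj-ε : ∀ g → conj g ε ≡ ε
  conj-ε g = trans (cong (_∙ g ⁻¹) (identityʳ g)) (inverseʳ g)

  conj-⁻¹ : ∀ g x → conj g (x ⁻¹) ≡ (conj g x) ⁻¹
  conj-⁻¹ g x = inverseʳ-unique (conj g x) (conj g (x ⁻¹)) (begin
    conj g x ∙ conj g (x ⁻¹)  ≡⟨ conj-∙ g x (x ⁻¹) ⟨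
    conj g (x ∙ x ⁻¹)         ≡⟨ cong (conj g) (inverseʳ x) ⟩
    conj g ε                  ≡⟨ conj-ε g ⟩
    ε                         ∎)

  conj-^ : ∀ g v a → conj g (v ^ a) ≡ (conj g v) ^ a
  conj-^ g v zero    = conj-ε g
  conj-^ g v (suc a) = trans (conj-∙ g v (v ^ a)) (cong (conj g v ∙_) (conj-^ g v a))

  commutator : Fin n → Fin n → Fin n
  commutator a b = a ∙ b ∙ a ⁻¹ ∙ b ⁻¹

  commutator≡ : ∀ a b → commutator a b ≡ a ∙ b ∙ (b ∙ a) ⁻¹
  commutator≡ a b = trans (assoc (a ∙ b) _ _) (cong (a ∙ b ∙_) (sym (⁻¹-anti-homo-∙ b a)))

  commutator≡conj : ∀ a b → commutator a b ≡ a ∙ conj b (a ⁻¹)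
  commutator≡conj a b = trans (cong (_∙ b ⁻¹) (assoc a b (a ⁻¹))) (assoc a _ _)

  commutator-⁻¹ : ∀ a b → (commutator a b) ⁻¹ ≡ conj b a ∙ a ⁻¹
  commutator-⁻¹ a b = sym (inverseʳ-unique (commutator a b) (conj b a ∙ a ⁻¹) (begin
    a ∙ b ∙ a ⁻¹ ∙ b ⁻¹ ∙ (b ∙ a ∙ b ⁻¹ ∙ a ⁻¹)    ≡⟨ assoc (commutator a b) (conj b a) (a ⁻¹) ⟨
    a ∙ b ∙ a ⁻¹ ∙ b ⁻¹ ∙ (b ∙ a ∙ b ⁻¹) ∙ a ⁻¹    ≡⟨ cong (λ z → a ∙ b ∙ a ⁻¹ ∙ b ⁻¹ ∙ z ∙ a ⁻¹) (assoc b a (b ⁻¹)) ⟩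
    a ∙ b ∙ a ⁻¹ ∙ b ⁻¹ ∙ (b ∙ (a ∙ b ⁻¹)) ∙ a ⁻¹  ≡⟨ cong (_∙ a ⁻¹) (x∙y⁻¹∙[y∙z]≡x∙z (a ∙ b ∙ a ⁻¹) b (a ∙ b ⁻¹)) ⟩
    a ∙ b ∙ a ⁻¹ ∙ (a ∙ b ⁻¹) ∙ a ⁻¹              ≡⟨ cong (_∙ a ⁻¹) (x∙y⁻¹∙[y∙z]≡x∙z (a ∙ b) a (b ⁻¹)) ⟩
    a ∙ b ∙ b ⁻¹ ∙ a ⁻¹                          ≡⟨ cong (_∙ a ⁻¹) (x∙y∙y⁻¹≡x a b) ⟩
    a ∙ a ⁻¹                                     ≡⟨ inverseʳ a ⟩
    ε                                            ∎))

  _∈⟨_⟩_ : Fin n → Fin n → Subset n → Set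
  x ∈⟨ u ⟩ S = ∃ λ a → (u ^ a) ⁻¹ ∙ x ∈ S

  _∈⟨_⟩?_ : ∀ x u S → Dec (x ∈⟨ u ⟩ S)
  x ∈⟨ u ⟩? S with finite-order u
  ... | e , u^e+1≡ε = map′ (λ (r , r∈) → toℕ r , r∈) reduce
                           (any? (λ (r : Fin (suc e)) → (u ^ toℕ r) ⁻¹ ∙ x ∈? S))
    where
    open FiniteOrder u e u^e+1≡ε
    reduce : x ∈⟨ u ⟩ S → ∃ λ (r : Fin (suc e)) → (u ^ toℕ r) ⁻¹ ∙ x ∈ S
    reduce (a , a∈) with ^-reduce a
    ... | r , r≤e , uᵃ≡uʳ = fromℕ< (s≤s r≤e)
      , subst (λ b → (u ^ b) ⁻¹ ∙ x ∈ S) (sym (toℕ-fromℕ< (s≤s r≤e))) (subst (λ v → v ⁻¹ ∙ x ∈ S) uᵃ≡uʳ a∈)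

  Supplements : Fin n → Subset n → Set
  Supplements w S = ∀ x → x ∈⟨ w ⟩ S

  module Subgroup {S : Subset n} (S-sub : IsSubgroup G S) where

    ε∈ : ε ∈ S
    ε∈ = proj₁ S-sub

    ∙-closed : ∀ {x y} → x ∈ S → y ∈ S → x ∙ y ∈ S
    ∙-closed = proj₁ (proj₂ S-sub) _ _

    ⁻¹-closed : ∀ {x} → x ∈ S → x ⁻¹ ∈ S
    ⁻¹-closed = proj₂ (proj₂ S-sub) _

    ^-closed : ∀ {x} → x ∈ S → ∀ a → x ^ a ∈ S
    ^-closed x∈ zero    = ε∈
    ^-closed x∈ (suc a) = ∙-closed x∈ (^-closed x∈ a)

    ∈⟨⟩⇒∈ : ∀ {u x} → u ∈ S → x ∈⟨ u ⟩ S → x ∈ S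
    ∈⟨⟩⇒∈ {u} {x} u∈S (a , a∈) = subst (_∈ S) (x∙[x⁻¹∙y]≡y (u ^ a) x) (∙-closed (^-closed u∈S a) a∈)

  module NormalSubgroup {S : Subset n} (S-normal : IsNormalSubgroup G S) where

    open Subgroup (proj₁ S-normal) public

    conj-closed : ∀ g {x} → x ∈ S → conj g x ∈ S
    conj-closed g = proj₂ S-normal g _

  ∩-isSubgroup : ∀ {S T} → IsSubgroup G S → IsSubgroup G T → IsSubgroup G (S ∩ T)
  ∩-isSubgroup {S} {T} S-sub T-sub =
      x∈p∩q⁺ (S.ε∈ , T.ε∈)
    , (λ x y x∈ y∈ → x∈p∩q⁺ ( S.∙-closed (proj₁ (x∈p∩q⁻ S T x∈)) (proj₁ (x∈p∩q⁻ S T y∈))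
                            , T.∙-closed (proj₂ (x∈p∩q⁻ S T x∈)) (proj₂ (x∈p∩q⁻ S T y∈))))
    , (λ x x∈ → x∈p∩q⁺ (S.⁻¹-closed (proj₁ (x∈p∩q⁻ S T x∈)) , T.⁻¹-closed (proj₂ (x∈p∩q⁻ S T x∈))))
    where
    module S = Subgroup S-sub
    module T = Subgroup T-sub

  supplement⇒⊆ : ∀ {S K L w} → IsSubgroup G K → IsSubgroup G L → L ⊆ K → K ∩ S ⊆ L
             → w ∈ L → Supplements w S → K ⊆ L
  supplement⇒⊆ {S} {K} {L} {w} K-sub L-sub L⊆K K∩S⊆L w∈L w-supp {k} k∈K =
    subst (_∈ L) (x∙[x⁻¹∙y]≡y (w ^ a) k) (L.∙-closed (L.^-closed w∈L a) (K∩S⊆L (x∈p∩q⁺ (t∈K , t∈S))))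
    where
    module K = Subgroup K-sub
    module L = Subgroup L-sub
    a : ℕ
    a = proj₁ (w-supp k)
    t∈S : (w ^ a) ⁻¹ ∙ k ∈ S
    t∈S = proj₂ (w-supp k)
    t∈K : (w ^ a) ⁻¹ ∙ k ∈ K
    t∈K = K.∙-closed (K.⁻¹-closed (K.^-closed (L⊆K w∈L) a)) k∈K

module Modulo {n : ℕ} (G : FinGroup n) {A : Subset n} (A-normal : IsNormalSubgroup G A) where

  open GroupTheory G
  open NormalSubgroup A-normal

  infix 4 _~_
  _~_ : Fin n → Fin n → Set
  x ~ y = x ∙ y ⁻¹ ∈ A

  ~-refl : ∀ {x} → x ~ x
  ~-refl {x} = subst (_∈ A) (sym (inverseʳ x)) ε∈

  ≡⇒~ : ∀ {x y} → x ≡ y → x ~ y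
  ≡⇒~ refl = ~-refl

  ~-sym : ∀ {x y} → x ~ y → y ~ x
  ~-sym {x} {y} x~y = subst (_∈ A) (trans (⁻¹-anti-homo-∙ x (y ⁻¹)) (cong (_∙ x ⁻¹) (⁻¹-involutive y))) (⁻¹-closed x~y)

  ~-trans : ∀ {x y z} → x ~ y → y ~ z → x ~ z
  ~-trans {x} {y} {z} x~y y~z = subst (_∈ A) (x∙y⁻¹∙[y∙z]≡x∙z x y (z ⁻¹)) (∙-closed x~y y~z)

  ~-setoid : Setoid 0ℓ 0ℓ
  ~-setoid = record { Carrier = Fin n ; _≈_ = _~_
                    ; isEquivalence = record { refl = ~-refl ; sym = ~-sym ; trans = ~-trans } }

  module ~-Reasoning = SetoidReasoning ~-setoid

  ~ε⇒∈ : ∀ {x} → x ~ ε → x ∈ A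
  ~ε⇒∈ {x} = subst (_∈ A) (trans (cong (x ∙_) ε⁻¹≈ε) (identityʳ x))

  ~⇒⁻¹∙∈ : ∀ {x y} → x ~ y → y ⁻¹ ∙ x ∈ A
  ~⇒⁻¹∙∈ {x} {y} x~y = subst (_∈ A) (begin
    y ⁻¹ ∙ (x ∙ y ⁻¹) ∙ y ⁻¹ ⁻¹  ≡⟨ cong (y ⁻¹ ∙ (x ∙ y ⁻¹) ∙_) (⁻¹-involutive y) ⟩
    y ⁻¹ ∙ (x ∙ y ⁻¹) ∙ y        ≡⟨ cong (_∙ y) (assoc (y ⁻¹) x (y ⁻¹)) ⟨
    y ⁻¹ ∙ x ∙ y ⁻¹ ∙ y          ≡⟨ x∙y⁻¹∙y≡x (y ⁻¹ ∙ x) y ⟩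
    y ⁻¹ ∙ x                     ∎) (conj-closed (y ⁻¹) x~y)
    where open ≡-Reasoning

  ⁻¹∙∈⇒~ : ∀ {x y} → y ⁻¹ ∙ x ∈ A → x ~ y
  ⁻¹∙∈⇒~ {x} {y} y⁻¹x∈ = subst (_∈ A) (cong (_∙ y ⁻¹) (x∙[x⁻¹∙y]≡y y x)) (conj-closed y y⁻¹x∈)

  ∈⟨⟩⇒~^ : ∀ {x u} → x ∈⟨ u ⟩ A → ∃ λ a → x ~ u ^ a
  ∈⟨⟩⇒~^ (a , a∈) = a , ⁻¹∙∈⇒~ a∈

  ∙-cong : ∀ {x x' y y'} → x ~ x' → y ~ y' → x ∙ y ~ x' ∙ y'
  ∙-cong {x} {x'} {y} {y'} x~x' y~y' = subst (_∈ A) eq (∙-closed (conj-closed x y~y') x~x')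
    where
    open ≡-Reasoning
    eq : conj x (y ∙ y' ⁻¹) ∙ (x ∙ x' ⁻¹) ≡ x ∙ y ∙ (x' ∙ y') ⁻¹
    eq = begin
      x ∙ (y ∙ y' ⁻¹) ∙ x ⁻¹ ∙ (x ∙ x' ⁻¹)  ≡⟨ x∙y⁻¹∙[y∙z]≡x∙z (x ∙ (y ∙ y' ⁻¹)) x (x' ⁻¹) ⟩
      x ∙ (y ∙ y' ⁻¹) ∙ x' ⁻¹               ≡⟨ cong (_∙ x' ⁻¹) (assoc x y (y' ⁻¹)) ⟨
      x ∙ y ∙ y' ⁻¹ ∙ x' ⁻¹                 ≡⟨ assoc (x ∙ y) _ _ ⟩
      x ∙ y ∙ (y' ⁻¹ ∙ x' ⁻¹)               ≡⟨ cong (x ∙ y ∙_) (⁻¹-anti-homo-∙ x' y') ⟨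
      x ∙ y ∙ (x' ∙ y') ⁻¹                  ∎

  ⁻¹-cong : ∀ {x y} → x ~ y → x ⁻¹ ~ y ⁻¹
  ⁻¹-cong {x} {y} x~y = subst (_∈ A) eq (conj-closed (x ⁻¹) (~-sym x~y))
    where
    open ≡-Reasoning
    eq : conj (x ⁻¹) (y ∙ x ⁻¹) ≡ x ⁻¹ ∙ y ⁻¹ ⁻¹
    eq = begin
      x ⁻¹ ∙ (y ∙ x ⁻¹) ∙ x ⁻¹ ⁻¹  ≡⟨ cong (_∙ x ⁻¹ ⁻¹) (assoc (x ⁻¹) y (x ⁻¹)) ⟨
      x ⁻¹ ∙ y ∙ x ⁻¹ ∙ x ⁻¹ ⁻¹    ≡⟨ x∙y∙y⁻¹≡x (x ⁻¹ ∙ y) (x ⁻¹) ⟩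
      x ⁻¹ ∙ y                     ≡⟨ cong (x ⁻¹ ∙_) (⁻¹-involutive y) ⟨
      x ⁻¹ ∙ y ⁻¹ ⁻¹               ∎

  ^-cong : ∀ {x y} → x ~ y → ∀ a → x ^ a ~ y ^ a
  ^-cong x~y zero    = ~-refl
  ^-cong x~y (suc a) = ∙-cong x~y (^-cong x~y a)

  conj-cong : ∀ g {x y} → x ~ y → conj g x ~ conj g y
  conj-cong g x~y = ∙-cong (∙-cong ~-refl x~y) ~-refl

  ^-distrib-∙ : ∀ {a b} → a ∙ b ~ b ∙ a → ∀ s → (a ∙ b) ^ s ~ a ^ s ∙ b ^ s
  ^-distrib-∙ {a} {b} ab~ba zero    = ≡⇒~ (sym (identityˡ ε))
  ^-distrib-∙ {a} {b} ab~ba (suc s) = begin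
    a ∙ b ∙ (a ∙ b) ^ s        ≈⟨ ∙-cong ~-refl (^-distrib-∙ ab~ba s) ⟩
    a ∙ b ∙ (a ^ s ∙ b ^ s)    ≡⟨ trans (assoc a b _) (cong (a ∙_) (sym (assoc b (a ^ s) (b ^ s)))) ⟩
    a ∙ (b ∙ a ^ s ∙ b ^ s)    ≈⟨ ∙-cong ~-refl (∙-cong (b-commutes s) ~-refl) ⟩
    a ∙ (a ^ s ∙ b ∙ b ^ s)    ≡⟨ trans (cong (a ∙_) (assoc (a ^ s) b (b ^ s))) (sym (assoc a (a ^ s) _)) ⟩
    a ∙ a ^ s ∙ (b ∙ b ^ s)    ∎
    where
    open ~-Reasoning
    b-commutes : ∀ s → b ∙ a ^ s ~ a ^ s ∙ b
    b-commutes zero    = ≡⇒~ (trans (identityʳ b) (sym (identityˡ b)))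
    b-commutes (suc s) = begin
      b ∙ (a ∙ a ^ s)    ≡⟨ assoc b a (a ^ s) ⟨
      b ∙ a ∙ a ^ s      ≈⟨ ∙-cong (~-sym ab~ba) ~-refl ⟩
      a ∙ b ∙ a ^ s      ≡⟨ assoc a b (a ^ s) ⟩
      a ∙ (b ∙ a ^ s)    ≈⟨ ∙-cong ~-refl (b-commutes s) ⟩
      a ∙ (a ^ s ∙ b)    ≡⟨ assoc a (a ^ s) b ⟨
      a ∙ a ^ s ∙ b      ∎

  ConjugatesArePowers : Fin n → Set
  ConjugatesArePowers u = ∀ h → ∃ λ c → conj h u ~ u ^ c

  conj-^-transfer : ∀ h u c → conj h u ~ u ^ c → ∀ x a → x ~ u ^ a → conj h x ~ x ^ c
  conj-^-transfer h u c hu~uᶜ x a x~uᵃ = begin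
    conj h x          ≈⟨ conj-cong h x~uᵃ ⟩
    conj h (u ^ a)    ≡⟨ conj-^ h u a ⟩
    (conj h u) ^ a    ≈⟨ ^-cong hu~uᶜ a ⟩
    (u ^ c) ^ a       ≡⟨ trans (^-*-assoc u c a) (trans (cong (u ^_) (*-comm c a)) (sym (^-*-assoc u a c))) ⟩
    (u ^ a) ^ c       ≈⟨ ^-cong x~uᵃ c ⟨
    x ^ c             ∎
    where open ~-Reasoning

  conj-∙-^ : ∀ {x x' g} c c' → conj x g ~ g ^ c → conj x' g ~ g ^ c' → conj (x ∙ x') g ~ g ^ (c * c')
  conj-∙-^ {x} {x'} {g} c c' xg~gᶜ x'g~gᶜ' = begin
    conj (x ∙ x') g     ≡⟨ conj-homo-∙ x x' g ⟩
    conj x (conj x' g)  ≈⟨ conj-cong x x'g~gᶜ' ⟩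
    conj x (g ^ c')     ≡⟨ conj-^ x g c' ⟩
    (conj x g) ^ c'     ≈⟨ ^-cong xg~gᶜ c' ⟩
    (g ^ c) ^ c'        ≡⟨ ^-*-assoc g c c' ⟩
    g ^ (c * c')        ∎
    where open ~-Reasoning

module PowerExtension {n : ℕ} (G : FinGroup n) {A : Subset n} (A-normal : IsNormalSubgroup G A)
                      {S : Subset n} (S-sub : IsSubgroup G S) (A⊆S : A ⊆ S)
                      {u : Fin n} (u-conj : Modulo.ConjugatesArePowers G A-normal u) where

  open GroupTheory G
  open Modulo G A-normal
  open Subgroup S-sub
  open ≡-Reasoning

  ⟨u⟩S : Subset n
  ⟨u⟩S = decSubset (λ x → x ∈⟨ u ⟩? S)

  ∈⟨u⟩S-intro : ∀ {x} a {t} → t ∈ S → x ≡ u ^ a ∙ t → x ∈ ⟨u⟩S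
  ∈⟨u⟩S-intro {x} a {t} t∈S x≡uᵃt = ∈-decSubset⁺ (_∈⟨ u ⟩? S) (a , subst (_∈ S) t≡ t∈S)
    where
    t≡ : t ≡ (u ^ a) ⁻¹ ∙ x
    t≡ = trans (sym (x⁻¹∙[x∙y]≡y (u ^ a) t)) (cong ((u ^ a) ⁻¹ ∙_) (sym x≡uᵃt))

  ∈⟨u⟩S-elim : ∀ {x} → x ∈ ⟨u⟩S → x ∈⟨ u ⟩ S
  ∈⟨u⟩S-elim = ∈-decSubset⁻ (_∈⟨ u ⟩? S)

  -- Conjugation by s acts on ⟨u⟩A/A as a power map u ↦ uᶜ, so uᵇ can be moved past s.
  slide : ∀ s b → ∃ λ k → ∃ λ m → m ∈ A × s ∙ u ^ b ≡ u ^ k ∙ (m ∙ s)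
  slide s b = b * c , (u ^ (b * c)) ⁻¹ ∙ conj s (u ^ b) , ~⇒⁻¹∙∈ su^b~ , (begin
    s ∙ u ^ b                                              ≡⟨ x∙y⁻¹∙y≡x (s ∙ u ^ b) s ⟨
    conj s (u ^ b) ∙ s                                     ≡⟨ cong (_∙ s) (x∙[x⁻¹∙y]≡y (u ^ (b * c)) _) ⟨
    u ^ (b * c) ∙ ((u ^ (b * c)) ⁻¹ ∙ conj s (u ^ b)) ∙ s  ≡⟨ assoc _ _ s ⟩
    u ^ (b * c) ∙ ((u ^ (b * c)) ⁻¹ ∙ conj s (u ^ b) ∙ s)  ∎)
    where
    c : ℕ
    c = proj₁ (u-conj s)
    su^b~ : conj s (u ^ b) ~ u ^ (b * c)
    su^b~ = ~-trans (conj-^-transfer s u c (proj₂ (u-conj s)) (u ^ b) b ~-refl) (≡⇒~ (^-*-assoc u b c))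

  ∙-closedᵘ : ∀ {x y} → x ∈ ⟨u⟩S → y ∈ ⟨u⟩S → x ∙ y ∈ ⟨u⟩S
  ∙-closedᵘ {x} {y} x∈ y∈ with ∈⟨u⟩S-elim x∈ | ∈⟨u⟩S-elim y∈
  ... | a , t∈ | b , t'∈ with slide ((u ^ a) ⁻¹ ∙ x) b
  ... | k , m , m∈A , t∙uᵇ≡ = ∈⟨u⟩S-intro (a + k) (∙-closed (∙-closed (A⊆S m∈A) t∈) t'∈) (begin
    x ∙ y                                ≡⟨ cong₂ _∙_ (sym (x∙[x⁻¹∙y]≡y (u ^ a) x)) (sym (x∙[x⁻¹∙y]≡y (u ^ b) y)) ⟩
    u ^ a ∙ t ∙ (u ^ b ∙ t')             ≡⟨ trans (assoc _ _ _) (cong (u ^ a ∙_) (sym (assoc t _ t'))) ⟩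
    u ^ a ∙ (t ∙ u ^ b ∙ t')             ≡⟨ cong (λ z → u ^ a ∙ (z ∙ t')) t∙uᵇ≡ ⟩
    u ^ a ∙ (u ^ k ∙ (m ∙ t) ∙ t')       ≡⟨ trans (cong (u ^ a ∙_) (assoc _ _ t')) (sym (assoc _ _ _)) ⟩
    u ^ a ∙ u ^ k ∙ (m ∙ t ∙ t')         ≡⟨ cong (_∙ (m ∙ t ∙ t')) (^-homo-+ u a k) ⟨
    u ^ (a + k) ∙ (m ∙ t ∙ t')           ∎)
    where
    t t' : Fin n
    t  = (u ^ a) ⁻¹ ∙ x
    t' = (u ^ b) ⁻¹ ∙ y

  ⁻¹-closedᵘ : ∀ {x} → x ∈ ⟨u⟩S → x ⁻¹ ∈ ⟨u⟩S
  ⁻¹-closedᵘ {x} x∈ with ∈⟨u⟩S-elim x∈ | finite-order u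
  ... | a , t∈ | e , u^e+1≡ε with slide (((u ^ a) ⁻¹ ∙ x) ⁻¹) (e * a)
  ... | k , m , m∈A , t⁻¹∙u^ea≡ = ∈⟨u⟩S-intro k (∙-closed (A⊆S m∈A) (⁻¹-closed t∈)) (begin
    x ⁻¹                  ≡⟨ cong _⁻¹ (sym (x∙[x⁻¹∙y]≡y (u ^ a) x)) ⟩
    (u ^ a ∙ t) ⁻¹        ≡⟨ ⁻¹-anti-homo-∙ _ _ ⟩
    t ⁻¹ ∙ (u ^ a) ⁻¹     ≡⟨ cong (t ⁻¹ ∙_) (FiniteOrder.^-⁻¹ u e u^e+1≡ε a) ⟩
    t ⁻¹ ∙ u ^ (e * a)    ≡⟨ t⁻¹∙u^ea≡ ⟩
    u ^ k ∙ (m ∙ t ⁻¹)    ∎)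
    where
    t : Fin n
    t = (u ^ a) ⁻¹ ∙ x

  ⟨u⟩S-isSubgroup : IsSubgroup G ⟨u⟩S
  ⟨u⟩S-isSubgroup = ∈⟨u⟩S-intro 0 ε∈ (sym (identityˡ ε))
                  , (λ _ _ → ∙-closedᵘ)
                  , (λ _ → ⁻¹-closedᵘ)

  ⟨u⟩S-isNormal : (∀ g {t} → t ∈ S → conj g t ∈ S) → IsNormalSubgroup G ⟨u⟩S
  ⟨u⟩S-isNormal S-conj = ⟨u⟩S-isSubgroup , conj-closedᵘ
    where
    conj-closedᵘ : ∀ g x → x ∈ ⟨u⟩S → conj g x ∈ ⟨u⟩S
    conj-closedᵘ g x x∈ with ∈⟨u⟩S-elim x∈
    ... | a , t∈ with slide g a
    ... | k , m , m∈A , g∙uᵃ≡ = ∈⟨u⟩S-intro k (∙-closed (A⊆S m∈A) (S-conj g t∈)) (begin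
      g ∙ x ∙ g ⁻¹                   ≡⟨ cong (λ z → g ∙ z ∙ g ⁻¹) (sym (x∙[x⁻¹∙y]≡y (u ^ a) x)) ⟩
      g ∙ (u ^ a ∙ t) ∙ g ⁻¹         ≡⟨ cong (_∙ g ⁻¹) (sym (assoc g _ t)) ⟩
      g ∙ u ^ a ∙ t ∙ g ⁻¹           ≡⟨ cong (λ z → z ∙ t ∙ g ⁻¹) g∙uᵃ≡ ⟩
      u ^ k ∙ (m ∙ g) ∙ t ∙ g ⁻¹     ≡⟨ trans (cong (_∙ g ⁻¹) (assoc _ _ t)) (assoc _ _ _) ⟩
      u ^ k ∙ (m ∙ g ∙ t ∙ g ⁻¹)     ≡⟨ cong (λ z → u ^ k ∙ (z ∙ g ⁻¹)) (assoc m g t) ⟩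
      u ^ k ∙ (m ∙ (g ∙ t) ∙ g ⁻¹)   ≡⟨ cong (u ^ k ∙_) (assoc m _ _) ⟩
      u ^ k ∙ (m ∙ conj g t)         ∎)
      where
      t : Fin n
      t = (u ^ a) ⁻¹ ∙ x

  S⊆⟨u⟩S : S ⊆ ⟨u⟩S
  S⊆⟨u⟩S {t} t∈ = ∈⟨u⟩S-intro 0 t∈ (sym (identityˡ t))

  u∈⟨u⟩S : u ∈ ⟨u⟩S
  u∈⟨u⟩S = ∈⟨u⟩S-intro 1 ε∈ (sym (trans (identityʳ (u ∙ ε)) (identityʳ u)))

crossing : {P : ℕ → Set} → (∀ j → Dec (P j)) → ¬ P 1 → ∀ r → P (suc r)
         → ∃ λ j → 1 ≤ j × j ≤ r × ¬ P j × P (suc j)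
crossing P? ¬P1 zero    P1 = ⊥-elim (¬P1 P1)
crossing P? ¬P1 (suc r) Pr+2 with P? (suc r)
... | no ¬Pr+1 = suc r , s≤s z≤n , ≤-refl , ¬Pr+1 , Pr+2
... | yes Pr+1 with crossing P? ¬P1 r Pr+1
...   | j , 1≤j , j≤r , ¬Pj , Pj+1 = j , 1≤j , m≤n⇒m≤1+n j≤r , ¬Pj , Pj+1

⊈-witness : ∀ {n} {S T : Subset n} → S ⊈ T → ∃ λ x → x ∈ S × x ∉ T
⊈-witness {n} {S} {T} S⊈T with ¬∀⟶∃¬ n (λ x → x ∈ S → x ∈ T) (λ x → x ∈? S →-dec x ∈? T) (λ S⊆T → S⊈T (S⊆T _))
... | x , x∉ with x ∈? S
...   | yes x∈S = x , x∈S , λ x∈T → x∉ (λ _ → x∈T)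
...   | no  x∉S = ⊥-elim (x∉ (λ x∈S → ⊥-elim (x∉S x∈S)))

module Layers {n : ℕ} (G : FinGroup n) where

  open GroupTheory G

  record CrossingLayer (T S : Subset n) : Set where
    field
      H A        : Subset n
      H-normal   : IsNormalSubgroup G H
      A-normal   : IsNormalSubgroup G A
      A⊆H        : A ⊆ H
      H/A-cyclic : CyclicFactor G H A
      H∩T⊈S      : H ∩ T ⊈ S
      A∩T⊆S      : A ∩ T ⊆ S

  crossingLayer : IsSupersolvable G → ∀ T S → ε ∈ S → T ⊈ S → CrossingLayer T S
  crossingLayer (r , M , M1≡⊤ , Mr+1≡1 , M-normal , M-cyclic) T S ε∈S T⊈S
    with crossing (λ j → M j ∩ T ⊆? S) ¬P1 r Pr+1
    where
    ¬P1 : ¬ (M 1 ∩ T ⊆ S)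
    ¬P1 M1∩T⊆S = T⊈S (λ x∈T → M1∩T⊆S (x∈p∩q⁺ (subst (_ ∈_) (sym M1≡⊤) ∈⊤ , x∈T)))
    Pr+1 : M (suc r) ∩ T ⊆ S
    Pr+1 {x} x∈ = subst (_∈ S) (sym (x∈⁅y⁆⇒x≡y ε (subst (x ∈_) Mr+1≡1 (proj₁ (x∈p∩q⁻ _ _ x∈))))) ε∈S
  ... | j , 1≤j , j≤r , ¬Pj , Pj+1 = record
    { H = M j ; A = M (suc j)
    ; H-normal = M-normal j 1≤j (m≤n⇒m≤1+n j≤r)
    ; A-normal = M-normal (suc j) (s≤s z≤n) (s≤s j≤r)
    ; A⊆H = proj₁ (M-cyclic j 1≤j j≤r)
    ; H/A-cyclic = proj₂ (M-cyclic j 1≤j j≤r)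
    ; H∩T⊈S = ¬Pj ; A∩T⊆S = Pj+1 }

*-rearrange : ∀ a b c d → a * b * c * d ≡ a * c * (b * d)
*-rearrange = solve-∀

module CyclicLayer {n : ℕ} (G : FinGroup n) {H A : Subset n}
                   (H-normal : IsNormalSubgroup G H) (A-normal : IsNormalSubgroup G A)
                   (H/A-cyclic : CyclicFactor G H A) where

  open GroupTheory G
  open Modulo G A-normal
  open NormalSubgroup H-normal using (conj-closed)

  g : Fin n
  g = proj₁ H/A-cyclic

  g∈H : g ∈ H
  g∈H = proj₁ (proj₂ H/A-cyclic)

  ~g^ : ∀ {v} → v ∈ H → ∃ λ a → v ~ g ^ a
  ~g^ {v} v∈H with proj₂ (proj₂ H/A-cyclic) v v∈H
  ... | a , y , y∈A , v≡gᵃy = a , ⁻¹∙∈⇒~ (subst (_∈ A) (sym (trans (cong ((g ^ a) ⁻¹ ∙_) v≡gᵃy) (x⁻¹∙[x∙y]≡y _ y))) y∈A)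

  g-conjugatesArePowers : ConjugatesArePowers g
  g-conjugatesArePowers x = ~g^ (conj-closed x g∈H)

  conjugatesArePowers : ∀ {v} → v ∈ H → ConjugatesArePowers v
  conjugatesArePowers v∈H x with g-conjugatesArePowers x | ~g^ v∈H
  ... | c , xg~gᶜ | a , v~gᵃ = c , conj-^-transfer x g c xg~gᶜ _ a v~gᵃ

  commutes : ∀ {v w} → v ∈ H → w ∈ H → v ∙ w ~ w ∙ v
  commutes v∈H w∈H with ~g^ v∈H | ~g^ w∈H
  ... | a , v~gᵃ | b , w~gᵇ = begin
    _ ∙ _          ≈⟨ ∙-cong v~gᵃ w~gᵇ ⟩
    g ^ a ∙ g ^ b  ≡⟨ trans (sym (^-homo-+ g a b)) (trans (cong (g ^_) (+-comm a b)) (^-homo-+ g b a)) ⟩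
    g ^ b ∙ g ^ a  ≈⟨ ∙-cong w~gᵇ v~gᵃ ⟨
    _ ∙ _          ∎
    where open ~-Reasoning

  conj-centralises : ∀ {v w} → v ∈ H → w ∈ H → conj v w ~ w
  conj-centralises {v} {w} v∈H w∈H =
    ~-trans (∙-cong (commutes v∈H w∈H) (~-refl {v ⁻¹})) (≡⇒~ (x∙y∙y⁻¹≡x w v))

  -- Every element of G acts on the cyclic group H/A by a power map, and these maps commute.
  commutator-centralises : ∀ x y {v} → v ∈ H → conj (commutator x y) v ~ v
  commutator-centralises x y {v} v∈H with ~g^ v∈H
  ... | a , v~gᵃ = ~-trans (conj-^-transfer (commutator x y) g 1 g-fixed v a v~gᵃ) (≡⇒~ (identityʳ v))
    where
    open ~-Reasoning
    c : Fin n → ℕ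
    c z = proj₁ (g-conjugatesArePowers z)
    acts : ∀ z → conj z g ~ g ^ c z
    acts z = proj₂ (g-conjugatesArePowers z)
    inverse-acts : ∀ z → g ~ g ^ (c z * c (z ⁻¹))
    inverse-acts z = begin
      g                  ≡⟨ trans (sym (conj-by-ε g)) (cong (λ w → conj w g) (sym (inverseʳ z))) ⟩
      conj (z ∙ z ⁻¹) g  ≈⟨ conj-∙-^ (c z) (c (z ⁻¹)) (acts z) (acts (z ⁻¹)) ⟩
      g ^ (c z * c (z ⁻¹)) ∎
    acts-commutator : conj (commutator x y) g ~ g ^ (c x * c y * c (x ⁻¹) * c (y ⁻¹))
    acts-commutator = conj-∙-^ (c x * c y * c (x ⁻¹)) (c (y ⁻¹))
      (conj-∙-^ (c x * c y) (c (x ⁻¹)) (conj-∙-^ (c x) (c y) (acts x) (acts y)) (acts (x ⁻¹)))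
      (acts (y ⁻¹))
    g-fixed : conj (commutator x y) g ~ g ^ 1
    g-fixed = begin
      conj (commutator x y) g                    ≈⟨ acts-commutator ⟩
      g ^ (c x * c y * c (x ⁻¹) * c (y ⁻¹))      ≡⟨ cong (g ^_) (*-rearrange (c x) (c y) (c (x ⁻¹)) (c (y ⁻¹))) ⟩
      g ^ (c x * c (x ⁻¹) * (c y * c (y ⁻¹)))    ≡⟨ ^-*-assoc g (c x * c (x ⁻¹)) (c y * c (y ⁻¹)) ⟨
      (g ^ (c x * c (x ⁻¹))) ^ (c y * c (y ⁻¹))  ≈⟨ ^-cong (inverse-acts x) (c y * c (y ⁻¹)) ⟨
      g ^ (c y * c (y ⁻¹))                       ≈⟨ inverse-acts y ⟨
      g                                          ≡⟨ identityʳ g ⟨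
      g ^ 1                                      ∎

module ChiefFactor {n : ℕ} (G : FinGroup n) {H A : Subset n}
                   (H-normal : IsNormalSubgroup G H) (A-normal : IsNormalSubgroup G A) (A⊂H : A ⊂ H)
                   (minimal : ∀ L → IsNormalSubgroup G L → A ⊆ L → L ⊆ H → L ≡ A ⊎ L ≡ H) where

  open GroupTheory G
  open Modulo G A-normal
  module H = NormalSubgroup H-normal
  module A = NormalSubgroup A-normal

  generated-by : ∀ {v} → v ∈ H → v ∉ A → ConjugatesArePowers v → ∀ {y} → y ∈ H → y ∈⟨ v ⟩ A
  generated-by {v} v∈H v∉A v-conj {y} y∈H =
    fill (minimal ⟨v⟩A (⟨v⟩A-isNormal A.conj-closed) A⊆⟨v⟩A ⟨v⟩A⊆H)
    where
    open PowerExtension G A-normal (proj₁ A-normal) (λ a∈ → a∈) v-conj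
      renaming (⟨u⟩S to ⟨v⟩A; ⟨u⟩S-isNormal to ⟨v⟩A-isNormal; S⊆⟨u⟩S to A⊆⟨v⟩A; u∈⟨u⟩S to v∈⟨v⟩A)
    ⟨v⟩A⊆H : ⟨v⟩A ⊆ H
    ⟨v⟩A⊆H {z} z∈ with ∈⟨u⟩S-elim z∈
    ... | a , t∈A = subst (_∈ H) (x∙[x⁻¹∙y]≡y (v ^ a) z) (H.∙-closed (H.^-closed v∈H a) (proj₁ A⊂H t∈A))
    fill : ⟨v⟩A ≡ A ⊎ ⟨v⟩A ≡ H → y ∈⟨ v ⟩ A
    fill (inj₁ ⟨v⟩A≡A) = ⊥-elim (v∉A (subst (v ∈_) ⟨v⟩A≡A v∈⟨v⟩A))
    fill (inj₂ ⟨v⟩A≡H) = ∈⟨u⟩S-elim (subst (y ∈_) (sym ⟨v⟩A≡H) y∈H)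

  supersolvable⇒powerConjugate : IsSupersolvable G → ∃ λ u → u ∈ H × u ∉ A × ConjugatesArePowers u
  supersolvable⇒powerConjugate ss = u , u∈H , u∉A , u-conj
    where
    H⊈A : H ⊈ A
    H⊈A H⊆A = proj₂ (proj₂ (proj₂ A⊂H)) (H⊆A (proj₁ (proj₂ (proj₂ A⊂H))))
    layer : Layers.CrossingLayer G H A
    layer = Layers.crossingLayer G ss H A A.ε∈ H⊈A
    open Layers.CrossingLayer layer
      renaming (H to M; A to M′; H-normal to M-normal; A-normal to M′-normal; A⊆H to M′⊆M)
    witness : ∃ λ u → u ∈ M ∩ H × u ∉ A
    witness = ⊈-witness H∩T⊈S
    u : Fin n
    u = proj₁ witness
    u∈M : u ∈ M
    u∈M = proj₁ (x∈p∩q⁻ M H (proj₁ (proj₂ witness)))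
    u∈H : u ∈ H
    u∈H = proj₂ (x∈p∩q⁻ M H (proj₁ (proj₂ witness)))
    u∉A : u ∉ A
    u∉A = proj₂ (proj₂ witness)
    u-conj : ConjugatesArePowers u
    u-conj h =
      let (c , hu~uᶜ) = CyclicLayer.conjugatesArePowers G M-normal M′-normal H/A-cyclic u∈M h
      in c , A∩T⊆S (x∈p∩q⁺ (hu~uᶜ , H.∙-closed (H.conj-closed h u∈H) (H.⁻¹-closed (H.^-closed u∈H c))))

  supersolvable⇒generated-by : IsSupersolvable G → ∀ {m} → m ∈ H → m ∉ A → ∀ {y} → y ∈ H → y ∈⟨ m ⟩ A
  supersolvable⇒generated-by ss {m} m∈H m∉A =
    generated-by m∈H m∉A (transfer (supersolvable⇒powerConjugate ss))
    where
    transfer : (∃ λ u → u ∈ H × u ∉ A × ConjugatesArePowers u) → ConjugatesArePowers m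
    transfer (u , u∈H , u∉A , u-conj) h =
      let (a , m~uᵃ) = ∈⟨⟩⇒~^ (generated-by u∈H u∉A u-conj m∈H)
          (c , hu~uᶜ) = u-conj h
      in c , conj-^-transfer h u c hu~uᶜ m a m~uᵃ

module MaximalSubgroup {n : ℕ} (G : FinGroup n) {B : Subset n} (B-sub : IsSubgroup G B)
                       (B-maximal : ∀ L → IsSubgroup G L → B ⊆ L → L ⊆ ⊤ → L ≡ B ⊎ L ≡ ⊤)
                       {H A : Subset n} (H-normal : IsNormalSubgroup G H) (A-normal : IsNormalSubgroup G A)
                       (A⊆H : A ⊆ H) (H/A-cyclic : CyclicFactor G H A) (A⊆B : A ⊆ B) (H⊈B : H ⊈ B) where

  open GroupTheory G
  open Modulo G A-normal
  open CyclicLayer G H-normal A-normal H/A-cyclic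
  module B = Subgroup B-sub
  module H = NormalSubgroup H-normal

  g∉B : g ∉ B
  g∉B g∈B = H⊈B λ v∈H → B.∈⟨⟩⇒∈ g∈B (proj₁ (~g^ v∈H) , A⊆B (~⇒⁻¹∙∈ (proj₂ (~g^ v∈H))))

  supplements : ∀ {v} → v ∈ H → v ∉ B → Supplements v B
  supplements {v} v∈H v∉B x = fill (B-maximal ⟨v⟩B ⟨v⟩B-isSubgroup B⊆⟨v⟩B (λ _ → ∈⊤))
    where
    open PowerExtension G A-normal B-sub A⊆B (conjugatesArePowers v∈H)
      renaming (⟨u⟩S to ⟨v⟩B; ⟨u⟩S-isSubgroup to ⟨v⟩B-isSubgroup; S⊆⟨u⟩S to B⊆⟨v⟩B; u∈⟨u⟩S to v∈⟨v⟩B)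
    fill : ⟨v⟩B ≡ B ⊎ ⟨v⟩B ≡ ⊤ → x ∈⟨ v ⟩ B
    fill (inj₁ ⟨v⟩B≡B) = ⊥-elim (v∉B (subst (v ∈_) ⟨v⟩B≡B v∈⟨v⟩B))
    fill (inj₂ ⟨v⟩B≡⊤) = ∈⟨u⟩S-elim (subst (x ∈_) (sym ⟨v⟩B≡⊤) ∈⊤)

  D : Subset n
  D = H ∩ B

  -- Writing x = gᵗ b, conjugation by b keeps D inside H ∩ B, and gᵗ centralises H modulo A ⊆ B.
  D-normal : IsNormalSubgroup G D
  D-normal = ∩-isSubgroup (proj₁ H-normal) B-sub , λ x d → D-conj x (supplements g∈H g∉B x)
    where
    D-conj : ∀ x {d} → x ∈⟨ g ⟩ B → d ∈ D → conj x d ∈ D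
    D-conj x {d} (t , b∈B) d∈D =
      x∈p∩q⁺ (H.conj-closed x d∈H , subst (_∈ B) (sym xdx⁻¹≡) (B.∙-closed (A⊆B gᵗd′~d′) d′∈B))
      where
      d∈H : d ∈ H
      d∈H = proj₁ (x∈p∩q⁻ H B d∈D)
      b : Fin n
      b = (g ^ t) ⁻¹ ∙ x
      d′ : Fin n
      d′ = conj b d
      d′∈B : d′ ∈ B
      d′∈B = B.∙-closed (B.∙-closed b∈B (proj₂ (x∈p∩q⁻ H B d∈D))) (B.⁻¹-closed b∈B)
      gᵗd′~d′ : conj (g ^ t) d′ ~ d′
      gᵗd′~d′ = conj-centralises (H.^-closed g∈H t) (H.conj-closed b d∈H)
      xdx⁻¹≡ : conj x d ≡ conj (g ^ t) d′ ∙ d′ ⁻¹ ∙ d′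
      xdx⁻¹≡ = begin
        conj x d                       ≡⟨ cong (λ z → conj z d) (x∙[x⁻¹∙y]≡y (g ^ t) x) ⟨
        conj (g ^ t ∙ b) d             ≡⟨ conj-homo-∙ (g ^ t) b d ⟩
        conj (g ^ t) d′                ≡⟨ x∙y⁻¹∙y≡x _ d′ ⟨
        conj (g ^ t) d′ ∙ d′ ⁻¹ ∙ d′   ∎
        where open ≡-Reasoning

  module D = Modulo G D-normal

  commutesᴰ : ∀ {v w} → v ∈ H → w ∈ H → v ∙ w D.~ w ∙ v
  commutesᴰ {v} {w} v∈H w∈H = x∈p∩q⁺ (A⊆H c∈A , A⊆B c∈A)
    where
    c∈A : v ∙ w ~ w ∙ v
    c∈A = commutes v∈H w∈H

  commutator∈H : ∀ {h} b → h ∈ H → commutator h b ∈ H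
  commutator∈H {h} b h∈H = subst (_∈ H) (sym (commutator≡conj h b)) (H.∙-closed h∈H (H.conj-closed b (H.⁻¹-closed h∈H)))

  -- If h and b commute modulo D then (hb)ˢ ≡ hˢ bˢ modulo D, and ⟨h⟩B = G transfers to ⟨hb⟩B = G.
  supplements-product : ∀ {h b} → h ∈ H → b ∈ B → h ∙ b ∉ B → commutator h b ∈ B → Supplements (h ∙ b) B
  supplements-product {h} {b} h∈H b∈B hb∉B [h,b]∈B x =
    s , subst (_∈ B) eq (B.∙-closed (B.∙-closed q∈B (B.⁻¹-closed (B.^-closed b∈B s))) r∈B)
    where
    h∉B : h ∉ B
    h∉B h∈B = hb∉B (B.∙-closed h∈B b∈B)
    s : ℕ
    s = proj₁ (supplements h∈H h∉B x)
    r∈B : (h ^ s) ⁻¹ ∙ x ∈ B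
    r∈B = proj₂ (supplements h∈H h∉B x)
    hb~bh : h ∙ b D.~ b ∙ h
    hb~bh = subst (_∈ D) (commutator≡ h b) (x∈p∩q⁺ (commutator∈H b h∈H , [h,b]∈B))
    q∈B : ((h ∙ b) ^ s) ⁻¹ ∙ (h ^ s ∙ b ^ s) ∈ B
    q∈B = proj₂ (x∈p∩q⁻ H B (D.~⇒⁻¹∙∈ (D.~-sym (D.^-distrib-∙ hb~bh s))))
    eq : ((h ∙ b) ^ s) ⁻¹ ∙ (h ^ s ∙ b ^ s) ∙ (b ^ s) ⁻¹ ∙ ((h ^ s) ⁻¹ ∙ x) ≡ ((h ∙ b) ^ s) ⁻¹ ∙ x
    eq = begin
      ((h ∙ b) ^ s) ⁻¹ ∙ (h ^ s ∙ b ^ s) ∙ (b ^ s) ⁻¹ ∙ ((h ^ s) ⁻¹ ∙ x)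
        ≡⟨ cong (λ z → z ∙ (b ^ s) ⁻¹ ∙ ((h ^ s) ⁻¹ ∙ x)) (assoc _ (h ^ s) (b ^ s)) ⟨
      ((h ∙ b) ^ s) ⁻¹ ∙ h ^ s ∙ b ^ s ∙ (b ^ s) ⁻¹ ∙ ((h ^ s) ⁻¹ ∙ x)
        ≡⟨ cong (_∙ ((h ^ s) ⁻¹ ∙ x)) (x∙y∙y⁻¹≡x _ (b ^ s)) ⟩
      ((h ∙ b) ^ s) ⁻¹ ∙ h ^ s ∙ ((h ^ s) ⁻¹ ∙ x)
        ≡⟨ x∙y∙[y⁻¹∙z]≡x∙z _ (h ^ s) x ⟩
      ((h ∙ b) ^ s) ⁻¹ ∙ x ∎
      where open ≡-Reasoning

  supplements-commutator : ∀ x y → commutator x y ∉ B → Supplements (commutator x y) B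
  supplements-commutator x y w∉B =
    subst (λ z → Supplements z B) hb≡w (supplements-product h∈H b∈B (λ hb∈B → w∉B (subst (_∈ B) hb≡w hb∈B)) [h,b]∈B)
    where
    w : Fin n
    w = commutator x y
    a : ℕ
    a = proj₁ (supplements g∈H g∉B w)
    h : Fin n
    h = g ^ a
    h∈H : h ∈ H
    h∈H = H.^-closed g∈H a
    b : Fin n
    b = h ⁻¹ ∙ w
    b∈B : b ∈ B
    b∈B = proj₂ (supplements g∈H g∉B w)
    hb≡w : h ∙ b ≡ w
    hb≡w = x∙[x⁻¹∙y]≡y h w
    wh~hw : w ∙ h ~ h ∙ w
    wh~hw = begin
      w ∙ h               ≡⟨ x∙y⁻¹∙y≡x (w ∙ h) w ⟨
      conj w h ∙ w        ≈⟨ ∙-cong (commutator-centralises x y h∈H) ~-refl ⟩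
      h ∙ w               ∎
      where open ~-Reasoning
    hb~bh : h ∙ b ~ b ∙ h
    hb~bh = begin
      h ∙ b               ≡⟨ hb≡w ⟩
      w                   ≡⟨ x⁻¹∙[x∙y]≡y h w ⟨
      h ⁻¹ ∙ (h ∙ w)      ≈⟨ ∙-cong ~-refl wh~hw ⟨
      h ⁻¹ ∙ (w ∙ h)      ≡⟨ assoc _ _ _ ⟨
      b ∙ h               ∎
      where open ~-Reasoning
    [h,b]∈B : commutator h b ∈ B
    [h,b]∈B = A⊆B (subst (_∈ A) (sym (commutator≡ h b)) hb~bh)

  -- Since ⟨c⟩B = G for c = [h, b] ∉ B, h ≡ cˢ modulo D for some s. As H/D is abelian and
  -- b h b⁻¹ h⁻¹ = c⁻¹, conjugating hb by h⁻ˢ gives h (h⁻¹ b h b⁻¹)ˢ b ≡ h c⁻ˢ b ≡ b modulo D.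
  conjugate-into : ∀ {h b} → h ∈ H → b ∈ B → commutator h b ∉ B → ∃ λ X → conj X (h ∙ b) ∈ B
  conjugate-into {h} {b} h∈H b∈B c∉B =
    (h ^ s) ⁻¹ , subst (_∈ B) (sym eq) (B.∙-closed (proj₂ (x∈p∩q⁻ H B (D.~ε⇒∈ Q~ε))) b∈B)
    where
    c : Fin n
    c = commutator h b
    c∈H : c ∈ H
    c∈H = commutator∈H b h∈H
    s : ℕ
    s = proj₁ (supplements c∈H c∉B h)
    h~cˢ : h D.~ c ^ s
    h~cˢ = D.⁻¹∙∈⇒~ (x∈p∩q⁺ (H.∙-closed (H.⁻¹-closed (H.^-closed c∈H s)) h∈H , proj₂ (supplements c∈H c∉B h)))
    X : Fin n
    X = h ^ s
    X∈H : X ∈ H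
    X∈H = H.^-closed h∈H s
    h⁻¹∈H : h ⁻¹ ∈ H
    h⁻¹∈H = H.⁻¹-closed h∈H
    bhb⁻¹∈H : conj b h ∈ H
    bhb⁻¹∈H = H.conj-closed b h∈H
    Q~ε : X ⁻¹ ∙ h ∙ conj b X D.~ ε
    Q~ε = begin
      X ⁻¹ ∙ h ∙ conj b X                 ≈⟨ D.∙-cong (commutesᴰ (H.⁻¹-closed X∈H) h∈H) D.~-refl ⟩
      h ∙ X ⁻¹ ∙ conj b X                 ≡⟨ assoc h _ _ ⟩
      h ∙ (X ⁻¹ ∙ conj b X)               ≡⟨ cong₂ (λ p q → h ∙ (p ∙ q)) (sym (⁻¹-^ h s)) (conj-^ b h s) ⟩
      h ∙ ((h ⁻¹) ^ s ∙ (conj b h) ^ s)   ≈⟨ D.∙-cong D.~-refl (D.^-distrib-∙ (commutesᴰ h⁻¹∈H bhb⁻¹∈H) s) ⟨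
      h ∙ (h ⁻¹ ∙ conj b h) ^ s           ≈⟨ D.∙-cong D.~-refl (D.^-cong (commutesᴰ h⁻¹∈H bhb⁻¹∈H) s) ⟩
      h ∙ (conj b h ∙ h ⁻¹) ^ s           ≡⟨ cong (λ z → h ∙ z ^ s) (commutator-⁻¹ h b) ⟨
      h ∙ (c ⁻¹) ^ s                      ≡⟨ cong (h ∙_) (⁻¹-^ c s) ⟩
      h ∙ (c ^ s) ⁻¹                      ≈⟨ D.∙-cong D.~-refl (D.⁻¹-cong h~cˢ) ⟨
      h ∙ h ⁻¹                            ≡⟨ inverseʳ h ⟩
      ε                                   ∎
      where open D.~-Reasoning
    eq : conj (X ⁻¹) (h ∙ b) ≡ X ⁻¹ ∙ h ∙ conj b X ∙ b
    eq = begin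
      X ⁻¹ ∙ (h ∙ b) ∙ X ⁻¹ ⁻¹        ≡⟨ cong (X ⁻¹ ∙ (h ∙ b) ∙_) (⁻¹-involutive X) ⟩
      X ⁻¹ ∙ (h ∙ b) ∙ X              ≡⟨ cong (_∙ X) (assoc (X ⁻¹) h b) ⟨
      X ⁻¹ ∙ h ∙ b ∙ X                ≡⟨ assoc (X ⁻¹ ∙ h) b X ⟩
      X ⁻¹ ∙ h ∙ (b ∙ X)              ≡⟨ cong (X ⁻¹ ∙ h ∙_) (x∙y⁻¹∙y≡x (b ∙ X) b) ⟨
      X ⁻¹ ∙ h ∙ (conj b X ∙ b)       ≡⟨ assoc (X ⁻¹ ∙ h) _ b ⟨
      X ⁻¹ ∙ h ∙ conj b X ∙ b         ∎
      where open ≡-Reasoning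

  module _ {K : Subset n} (K-sub : IsSubgroup G K) (KB≡G : ProdIsWhole G K B) where

    module K = Subgroup K-sub

    supplementing-element : ∀ {L} → IsSubgroup G L → L ⊆ K → K ∩ B ⊆ L → ∀ {y} → y ∈ L → y ∉ B
                          → ∃ λ w → w ∈ L × Supplements w B
    supplementing-element {L} L-sub L⊆K K∩B⊆L {y} y∈L y∉B = from-power (supplements g∈H g∉B y)
      where
      module L = Subgroup L-sub
      Goal : Set
      Goal = ∃ λ w → w ∈ L × Supplements w B

      -- A conjugate z of y by an element of K lies in K ∩ B ⊆ L, so the commutator y z⁻¹ ∈ L works.
      from-conjugator : ∀ {X} → conj X y ∈ B → InProd G K B (X ⁻¹) → Goal
      from-conjugator {X} Xy∈B (k , b , k∈K , b∈B , X⁻¹≡kb) = w , w∈L , supplements-commutator y (k ⁻¹) w∉B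
        where
        open ≡-Reasoning
        bX≡k⁻¹ : b ∙ X ≡ k ⁻¹
        bX≡k⁻¹ = begin
          b ∙ X               ≡⟨ cong (b ∙_) (⁻¹-involutive X) ⟨
          b ∙ X ⁻¹ ⁻¹         ≡⟨ cong (λ z → b ∙ z ⁻¹) X⁻¹≡kb ⟩
          b ∙ (k ∙ b) ⁻¹      ≡⟨ cong (b ∙_) (⁻¹-anti-homo-∙ k b) ⟩
          b ∙ (b ⁻¹ ∙ k ⁻¹)   ≡⟨ x∙[x⁻¹∙y]≡y b (k ⁻¹) ⟩
          k ⁻¹                ∎
        z : Fin n
        z = conj (k ⁻¹) y
        z∈B : z ∈ B
        z∈B = subst (_∈ B) (trans (sym (conj-homo-∙ b X y)) (cong (λ v → conj v y) bX≡k⁻¹))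
                (B.∙-closed (B.∙-closed b∈B Xy∈B) (B.⁻¹-closed b∈B))
        z∈K : z ∈ K
        z∈K = K.∙-closed (K.∙-closed (K.⁻¹-closed k∈K) (L⊆K y∈L)) (K.⁻¹-closed (K.⁻¹-closed k∈K))
        z∈L : z ∈ L
        z∈L = K∩B⊆L (x∈p∩q⁺ (z∈K , z∈B))
        w : Fin n
        w = commutator y (k ⁻¹)
        w≡yz⁻¹ : w ≡ y ∙ z ⁻¹
        w≡yz⁻¹ = trans (commutator≡conj y (k ⁻¹)) (cong (y ∙_) (conj-⁻¹ (k ⁻¹) y))
        w∈L : w ∈ L
        w∈L = subst (_∈ L) (sym w≡yz⁻¹) (L.∙-closed y∈L (L.⁻¹-closed z∈L))
        w∉B : w ∉ B
        w∉B w∈B = y∉B (subst (_∈ B) (trans (cong (_∙ z) w≡yz⁻¹) (x∙y⁻¹∙y≡x y z)) (B.∙-closed w∈B z∈B))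

      from-decomposition : ∀ {h b} → h ∈ H → b ∈ B → y ≡ h ∙ b → Dec (commutator h b ∈ B) → Goal
      from-decomposition h∈H b∈B y≡hb (yes [h,b]∈B) =
        y , y∈L , subst (λ v → Supplements v B) (sym y≡hb)
                    (supplements-product h∈H b∈B (λ hb∈B → y∉B (subst (_∈ B) (sym y≡hb) hb∈B)) [h,b]∈B)
      from-decomposition h∈H b∈B y≡hb (no [h,b]∉B) =
        let (X , Xhb∈B) = conjugate-into h∈H b∈B [h,b]∉B
        in from-conjugator (subst (λ v → conj X v ∈ B) (sym y≡hb) Xhb∈B) (KB≡G (X ⁻¹))

      from-power : y ∈⟨ g ⟩ B → Goal
      from-power (t , b∈B) =
        from-decomposition (H.^-closed g∈H t) b∈B (sym (x∙[x⁻¹∙y]≡y (g ^ t) y)) (commutator (g ^ t) ((g ^ t) ⁻¹ ∙ y) ∈? B)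

    intersection-isMaximal : IsMaximalIn G K (K ∩ B)
    intersection-isMaximal = ∩-isSubgroup K-sub B-sub , (p∩q⊆p K B , k , k∈K , k∉K∩B) , maximal
      where
      k : Fin n
      k = proj₁ (KB≡G g)
      k∈K : k ∈ K
      k∈K = proj₁ (proj₂ (proj₂ (KB≡G g)))
      k∉K∩B : k ∉ K ∩ B
      k∉K∩B k∈K∩B =
        let (_ , b , _ , b∈B , g≡kb) = KB≡G g
        in g∉B (subst (_∈ B) (sym g≡kb) (B.∙-closed (p∩q⊆q K B k∈K∩B) b∈B))
      maximal : ∀ L → IsSubgroup G L → K ∩ B ⊆ L → L ⊆ K → L ≡ K ∩ B ⊎ L ≡ K
      maximal L L-sub K∩B⊆L L⊆K = by-cases (L ⊆? B)
        where
        by-cases : Dec (L ⊆ B) → L ≡ K ∩ B ⊎ L ≡ K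
        by-cases (yes L⊆B) = inj₁ (⊆-antisym (λ x∈L → x∈p∩q⁺ (L⊆K x∈L , L⊆B x∈L)) K∩B⊆L)
        by-cases (no L⊈B) =
          let (y , y∈L , y∉B) = ⊈-witness L⊈B
              (w , w∈L , w-supp) = supplementing-element L-sub L⊆K K∩B⊆L y∈L y∉B
          in inj₂ (⊆-antisym L⊆K (supplement⇒⊆ K-sub L-sub L⊆K K∩B⊆L w∈L w-supp))

module _ {n : ℕ} (G : FinGroup n) where

  open GroupTheory G

  supersolvable⇒intersection-isMaximal : IsSupersolvable G → ∀ {K B} → IsSubgroup G K
                                       → IsMaximalIn G ⊤ B → ProdIsWhole G K B → IsMaximalIn G K (K ∩ B)
  supersolvable⇒intersection-isMaximal ss {K} {B} K-sub (B-sub , (_ , x , _ , x∉B) , B-maximal) KB≡G =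
    MaximalSubgroup.intersection-isMaximal G B-sub B-maximal H-normal A-normal A⊆H H/A-cyclic A⊆B H⊈B K-sub KB≡G
    where
    open Layers.CrossingLayer (Layers.crossingLayer G ss ⊤ B (proj₁ B-sub) (λ ⊤⊆B → x∉B (⊤⊆B ∈⊤)))
    A⊆B : A ⊆ B
    A⊆B a∈A = A∩T⊆S (x∈p∩q⁺ (a∈A , ∈⊤))
    H⊈B : H ⊈ B
    H⊈B H⊆B = H∩T⊈S (λ x∈H∩⊤ → H⊆B (proj₁ (x∈p∩q⁻ H ⊤ x∈H∩⊤)))

  ProdIsWhole-monoˡ : ∀ {K₀ K B} → K₀ ⊆ K → ProdIsWhole G K₀ B → ProdIsWhole G K B
  ProdIsWhole-monoˡ K₀⊆K K₀B≡G x =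
    let (k , b , k∈K₀ , b∈B , x≡kb) = K₀B≡G x in k , b , K₀⊆K k∈K₀ , b∈B , x≡kb

  InProd? : ∀ S T x → Dec (InProd G S T x)
  InProd? S T x = map′ (λ (h , h∈S , t∈T) → h , h ⁻¹ ∙ x , h∈S , t∈T , sym (x∙[x⁻¹∙y]≡y h x))
                       (λ (h , k , h∈S , k∈T , x≡hk) → h , h∈S , subst (_∈ T) (trans (sym (x⁻¹∙[x∙y]≡y h k)) (cong (h ⁻¹ ∙_) (sym x≡hk))) k∈T)
                       (any? (λ h → h ∈? S ×-dec h ⁻¹ ∙ x ∈? T))

  supplement-by-generator : ∀ {K₀ H A B m} → IsSubgroup G K₀ → IsSubgroup G B → m ∈ K₀
                          → (∀ {y} → y ∈ H → y ∈⟨ m ⟩ A) → ProdIsWhole G H B → A ⊆ B → ProdIsWhole G K₀ B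
  supplement-by-generator {K₀} {H} {A} {B} {m} K₀-sub B-sub m∈K₀ H=⟨m⟩A HB≡G A⊆B x =
    let (h , b , h∈H , b∈B , x≡hb) = HB≡G x
        (a , t∈A) = H=⟨m⟩A h∈H
    in m ^ a , (m ^ a) ⁻¹ ∙ h ∙ b , K₀.^-closed m∈K₀ a , B.∙-closed (A⊆B t∈A) b∈B
     , trans x≡hb (trans (cong (_∙ b) (sym (x∙[x⁻¹∙y]≡y (m ^ a) h))) (assoc (m ^ a) _ b))
    where
    module K₀ = Subgroup K₀-sub
    module B = Subgroup B-sub

  uncovered-element : ∀ {S K₀ K₁} → ¬ (∀ x → x ∈ K₀ → InProd G S K₁ x) → ∃ λ x → x ∈ K₀ × ¬ InProd G S K₁ x
  uncovered-element {S} {K₀} {K₁} not-covered =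
    let (x , x∈K₀ , x∉SK₁) = ⊈-witness K₀⊈SK₁ in x , x∈K₀ , λ x∈ → x∉SK₁ (∈-decSubset⁺ (InProd? S K₁) x∈)
    where
    K₀⊈SK₁ : K₀ ⊈ decSubset (InProd? S K₁)
    K₀⊈SK₁ K₀⊆SK₁ = not-covered (λ x x∈K₀ → ∈-decSubset⁻ (InProd? S K₁) (K₀⊆SK₁ x∈K₀))

  λˢˢ-witness : ∀ {k N K₀ K₁ i} → N (suc k) ≡ ⁅ ε ⁆ → IsSubgroup G K₀ → IsMaximalIn G K₀ K₁
              → LambdaSS G k N K₀ K₁ i → i ≤ k × ∃ λ m → m ∈ K₀ × m ∈ N i × m ∉ N (suc i)
  λˢˢ-witness {k} {N} {K₀} {K₁} {i} Nk+1≡1 K₀-sub (_ , (K₁⊆K₀ , x₀ , x₀∈K₀ , x₀∉K₁) , _)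
              (_ , i≤k+1 , covered , not-covered) =
    let (x , x∈K₀ , x∉N[i+1]K₁) = uncovered-element (not-covered (suc i) (n<1+n i) (s≤s i≤k))
        (m , k₁ , m∈Ni , k₁∈K₁ , x≡mk₁) = covered x x∈K₀
        m∈K₀ = subst (_∈ K₀) (trans (cong (_∙ k₁ ⁻¹) x≡mk₁) (x∙y∙y⁻¹≡x m k₁))
                 (K₀.∙-closed x∈K₀ (K₀.⁻¹-closed (K₁⊆K₀ k₁∈K₁)))
    in i≤k , m , m∈K₀ , m∈Ni , λ m∈ → x∉N[i+1]K₁ (m , k₁ , m∈ , k₁∈K₁ , x≡mk₁)
    where
    module K₀ = Subgroup K₀-sub
    i≤k : i ≤ k
    i≤k with m≤n⇒m<n∨m≡n i≤k+1
    ... | inj₁ (s≤s i≤k) = i≤k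
    ... | inj₂ refl =
      let (h , k₁ , h∈N , k₁∈K₁ , x₀≡hk₁) = covered x₀ x₀∈K₀
          h≡ε = x∈⁅y⁆⇒x≡y ε (subst (h ∈_) Nk+1≡1 h∈N)
      in ⊥-elim (x₀∉K₁ (subst (_∈ K₁) (sym (trans x₀≡hk₁ (trans (cong (_∙ k₁) h≡ε) (identityˡ k₁)))) k₁∈K₁))

  complement-supplements : IsSupersolvable G → ∀ {k N K₀ K₁ i B} → IsChiefSeries G k N
                         → IsSubgroup G K₀ → IsMaximalIn G K₀ K₁ → LambdaSS G k N K₀ K₁ i
                         → IsComplement G N i B → ProdIsWhole G K₀ B
  complement-supplements ss {i = i} {B} (_ , Nk+1≡1 , N-normal , N-chief) K₀-sub K₁-max λ≡i@(1≤i , _) (B-sub , NiB≡G , Ni∩B≡Ni+1) =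
    let (i≤k , m , m∈K₀ , m∈Ni , m∉Ni+1) = λˢˢ-witness Nk+1≡1 K₀-sub K₁-max λ≡i
        (Ni+1⊂Ni , minimal) = N-chief i 1≤i i≤k
        Ni=⟨m⟩Ni+1 = ChiefFactor.supersolvable⇒generated-by G
                       (N-normal i 1≤i (m≤n⇒m≤1+n i≤k)) (N-normal (suc i) (s≤s z≤n) (s≤s i≤k))
                       Ni+1⊂Ni minimal ss m∈Ni m∉Ni+1
    in supplement-by-generator K₀-sub B-sub m∈K₀ Ni=⟨m⟩Ni+1 NiB≡G
         (λ a∈ → p∩q⊆q _ B (subst (_ ∈_) (sym Ni∩B≡Ni+1) a∈))

lemma4p7 : ∀ {n} (G : FinGroup n) → IsSupersolvable G
  → (k : ℕ) (N : ℕ → Subset n) → IsChiefSeries G k N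
  → (∀ (K B : Subset n) → IsSubgroup G K → IsMaximalIn G ⊤ B
       → ProdIsWhole G K B → IsMaximalIn G K (K ∩ B))
  × (∀ (K₀ K₁ : Subset n) (i : ℕ) → IsSubgroup G K₀ → IsMaximalIn G K₀ K₁
       → LambdaSS G k N K₀ K₁ i
       → ∀ (B : Subset n) → IsComplement G N i B
       → ∀ (K : Subset n) → IsSubgroup G K → K₀ ⊆ K
       → ProdIsWhole G K₀ B × ProdIsWhole G K B)
lemma4p7 G ss k N chief =
    (λ K B K-sub B-maximal KB≡G → supersolvable⇒intersection-isMaximal G ss K-sub B-maximal KB≡G)
  , (λ K₀ K₁ i K₀-sub K₁-maximal λ≡i B B-complement K K-sub K₀⊆K →
       let K₀B≡G = complement-supplements G ss chief K₀-sub K₁-maximal λ≡i B-complement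
       in K₀B≡G , ProdIsWhole-monoˡ G K₀⊆K K₀B≡G)
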